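{- For each integer $k\ge 1$ and each integer $r\ge 1$, if $G$ is a connected $r$-regular graph of order $n$, then there exists a connected $r'$-regular graph $G'$ of order $n'=(k+2)n$ such that $r'=(k+2)r$ and $\gamma_{p,k}(G')=\gamma_t(G)$.
   Context: All graphs are finite and simple; $N_G[v]$ is the closed neighborhood of $v$ and $N_G[S]=\bigcup_{v\in S}N_G[v]$. For an integer $k\ge 0$ and $S\subseteq V(G)$, define $P^0_G(S)=N_G[S]$ and $P^{i+1}_G(S)=\bigcup\{N_G[v]: v\in P^i_G(S) \text{ and } |N_G[v]\setminus P^i_G(S)|\le k\}$; these stabilize at $P^\infty_G(S)$. $S$ is a $k$-power dominating set if $P^\infty_G(S)=V(G)$, and $\gamma_{p,k}(G)$ is the minimum cardinality of such a set. A total dominating set of $G$ is a set $S$ such that every vertex of $G$ is adjacent to some vertex of $S$; $\gamma_t(G)$ is the minimum cardinality of a total dominating set. -}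

module Defs where

open import Data.Nat using (ℕ; zero; suc; _+_; _*_; _≤_; _≤ᵇ_)
open import Data.Bool using (Bool; true; false; _∧_; _∨_; if_then_else_)
open import Data.Fin using (Fin; _≟_)
open import Data.Fin.Subset using (Subset; ⋃; _─_; ∣_∣; ⊥; ⊤; _∈_)
open import Data.Vec using (tabulate; lookup)
open import Data.List using (List; map; allFin)
open import Data.Product using (Σ; ∃; ∃-syntax; _×_; _,_)
open import Relation.Nullary using (¬_)
open import Relation.Nullary.Decidable using (⌊_⌋)
open import Relation.Binary.PropositionalEquality using (_≡_)

record Graph (n : ℕ) : Set where
  field
    adj   : Fin n → Fin n → Bool
    sym   : ∀ u v → adj u v ≡ adj v u
    irrefl : ∀ v → adj v v ≡ false
open Graph public

module _ {n : ℕ} (G : Graph n) where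

  N : Fin n → Subset n
  N v = tabulate (λ u → adj G v u)

  deg : Fin n → ℕ
  deg v = ∣ N v ∣

  Regular : ℕ → Set
  Regular r = ∀ v → deg v ≡ r

  data Reachable : Fin n → Fin n → Set where
    here  : ∀ {v} → Reachable v v
    step  : ∀ {u w v} → adj G u w ≡ true → Reachable w v → Reachable u v

  Connected : Set
  Connected = ∀ u v → Reachable u v

  Nc : Fin n → Subset n
  Nc v = tabulate (λ u → adj G v u ∨ ⌊ u ≟ v ⌋)

  NcSet : Subset n → Subset n
  NcSet S = ⋃ (map (λ v → if lookup S v then Nc v else ⊥) (allFin n))

  P : ℕ → Subset n → ℕ → Subset n
  P k S zero = NcSet S
  P k S (suc i) =
    ⋃ (map (λ v → if lookup (P k S i) v ∧ (∣ Nc v ─ P k S i ∣ ≤ᵇ k) then Nc v else ⊥)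
           (allFin n))

  _∈P∞[_,_] : Fin n → ℕ → Subset n → Set
  v ∈P∞[ k , S ] = ∃[ i ] (v ∈ P k S i)

  IsKPowerDominating : ℕ → Subset n → Set
  IsKPowerDominating k S = ∀ v → v ∈P∞[ k , S ]

  IsTotalDominating : Subset n → Set
  IsTotalDominating S = ∀ v → ∃[ u ] (u ∈ S × adj G v u ≡ true)

  IsMinSize : (Subset n → Set) → ℕ → Set
  IsMinSize Q m = (∃[ S ] (Q S × ∣ S ∣ ≡ m)) × (∀ S → Q S → m ≤ ∣ S ∣)

  PowerDomNumber : ℕ → ℕ → Set
  PowerDomNumber k m = IsMinSize (IsKPowerDominating k) m

  TotalDomNumber : ℕ → Set
  TotalDomNumber m = IsMinSize IsTotalDominating m

module Submission where

-- The blow-up G[M] of a graph G on n vertices has vertex set Fin M × V(G), encoded as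
-- Fin (M * n) through 'combine'; (i, u) and (j, w) are adjacent iff u ~ w in G (the
-- lexicographic product of G with M independent vertices). It is (M r)-regular when G is
-- r-regular, and connected when G is connected and has no isolated vertex. For M = k + 2:
--  * γ_{p,k}(G[M]) ≤ γ_t(G): a total dominating set of G placed on one layer already
--    dominates G[M], since (i, u) is adjacent to (0, t) for the G-neighbour t ∈ T of u.
--  * γ_t(G) ≤ γ_{p,k}(G[M]): let S be k-power dominating and c(u) the number of copies
--    of u in S. If no vertex of S projects to a G-neighbour of u and c(u) ≤ 1, then more
--    than k copies of u lie outside S and none of them is ever observed, because any
--    vertex able to observe one of them sees all of them. So such u has c(u) ≥ 2, and the
--    projection of S plus one chosen neighbour of every u with c(u) ≥ 2 is a total
--    dominating set of size ≤ Σ_u ([c(u) ≥ 1] + [c(u) ≥ 2]) ≤ Σ_u c(u) = |S|.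

open import Defs renaming (sym to adj-sym)
open import Data.Nat using (ℕ; zero; suc; _*_; _+_; _≤_; _<_; _≥_; _≤ᵇ_; z≤n; s≤s; s≤s⁻¹; _≤?_; _<?_)
open import Data.Nat.Properties
  using (+-0-commutativeMonoid; ≤-refl; ≤-reflexive; ≤-trans; <-≤-trans; +-mono-≤; +-monoʳ-≤;
         m≤m+n; m≤n+m; +-assoc; +-comm; *-zeroʳ; *-identityʳ; +-identityʳ; ≤ᵇ⇒≤; ≤⇒≤ᵇ; <⇒≱; ≰⇒>; ≮⇒≥;
         module ≤-Reasoning)
open import Data.Bool using (Bool; true; false; _∧_; _∨_; not; if_then_else_)
open import Data.Bool.Properties using (T-≡) renaming (_≟_ to _≟ᵇ_)
open import Data.Fin using (Fin; zero; suc; _↑ˡ_; _↑ʳ_; combine; remQuot; _≟_)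
open import Data.Fin.Properties using (remQuot-combine; combine-remQuot; any?; all?)
open import Data.Fin.Subset using (Subset; ∣_∣; ⋃; _∪_; _─_; ⊥; ⊤; ⁅_⁆; _∈_; _∉_; _⊆_; Nonempty)
open import Data.Fin.Subset.Properties
  using (x∈p∪q⁻; x∈p∪q⁺; ∉⊥; ∈⊤; ∣⊥∣≡0; ∣⁅x⁆∣≡1; x∈⁅x⁆; nonempty?; Empty-unique;
         p⊆q⇒∣p∣≤∣q∣; x∈p∧x∉q⇒x∈p─q; anySubset?; _∈?_)
open import Data.Vec using ([]; _∷_; lookup; tabulate)
open import Data.Vec.Properties using (lookup∘tabulate; lookup-zipWith; []=⇒lookup; lookup⇒[]=)
open import Data.List using (List; map; allFin) renaming ([] to []ₗ; _∷_ to _∷ₗ_)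
import Data.List as List
open import Data.List.Properties using (map-tabulate)
open import Data.List.Relation.Unary.Any using (here; there)
open import Data.List.Membership.Propositional using () renaming (_∈_ to _∈ₗ_)
open import Data.List.Membership.Propositional.Properties using (∈-allFin)
open import Data.Product using (∃-syntax; _×_; _,_; proj₁; proj₂)
open import Data.Sum using (_⊎_; inj₁; inj₂)
open import Data.Empty using (⊥-elim)
open import Function using (_∘_; id)
open import Function.Bundles using (Equivalence)
open import Relation.Nullary using (Dec; yes; no; contradiction)
open import Relation.Nullary.Decidable using (does; dec-true; _×-dec_)
open import Relation.Binary.PropositionalEquality
  using (_≡_; _≢_; refl; sym; trans; cong; cong₂; subst; module ≡-Reasoning)
open import Algebra.Properties.CommutativeMonoid.Sum +-0-commutativeMonoid
  using (sum-syntax; ∑-distrib-+; ∑-comm; sum-cong-≗)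

bit : Bool → ℕ
bit true  = 1
bit false = 0

∑-mono : ∀ {n} {f g : Fin n → ℕ} → (∀ i → f i ≤ g i) → ∑[ i < n ] f i ≤ ∑[ i < n ] g i
∑-mono {zero}  f≤g = z≤n
∑-mono {suc n} f≤g = +-mono-≤ (f≤g zero) (∑-mono (f≤g ∘ suc))

term≤∑ : ∀ {n} (f : Fin n → ℕ) i → f i ≤ ∑[ j < n ] f j
term≤∑ f zero    = m≤m+n (f zero) _
term≤∑ f (suc i) = ≤-trans (term≤∑ (f ∘ suc) i) (m≤n+m _ (f zero))

∑-const : ∀ m c → ∑[ i < m ] c ≡ m * c
∑-const zero    c = refl
∑-const (suc m) c = cong (c +_) (∑-const m c)

∑-↑ : ∀ a b (f : Fin (a + b) → ℕ) →
  ∑[ x < a + b ] f x ≡ ∑[ i < a ] f (i ↑ˡ b) + ∑[ j < b ] f (a ↑ʳ j)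
∑-↑ zero    b f = refl
∑-↑ (suc a) b f = trans (cong (f zero +_) (∑-↑ a b (f ∘ suc))) (sym (+-assoc (f zero) _ _))

∑-combine : ∀ m n (f : Fin (m * n) → ℕ) →
  ∑[ x < m * n ] f x ≡ ∑[ i < m ] ∑[ u < n ] f (combine i u)
∑-combine zero    n f = refl
∑-combine (suc m) n f =
  trans (∑-↑ n (m * n) f) (cong (∑[ u < n ] f (u ↑ˡ (m * n)) +_) (∑-combine m n (λ x → f (n ↑ʳ x))))

∑-indicator : ∀ {n} (u : Fin n) (b : Fin n → Bool) →
  ∑[ w < n ] bit (does (w ≟ u) ∧ b w) ≡ bit (b u)
∑-indicator {suc n} zero    b = begin
  bit (b zero) + ∑[ w < n ] 0  ≡⟨ cong (bit (b zero) +_) (trans (∑-const n 0) (*-zeroʳ n)) ⟩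
  bit (b zero) + 0             ≡⟨ +-identityʳ _ ⟩
  bit (b zero)                 ∎
  where open ≡-Reasoning
∑-indicator {suc n} (suc u) b = ∑-indicator u (b ∘ suc)

∣p∣≡∑ : ∀ {n} (p : Subset n) → ∣ p ∣ ≡ ∑[ x < n ] bit (lookup p x)
∣p∣≡∑ []          = refl
∣p∣≡∑ (true ∷ p)  = cong suc (∣p∣≡∑ p)
∣p∣≡∑ (false ∷ p) = ∣p∣≡∑ p

∈-tabulate⁺ : ∀ {n} {f : Fin n → Bool} {x} → f x ≡ true → x ∈ tabulate f
∈-tabulate⁺ {f = f} {x} fx = lookup⇒[]= x _ (trans (lookup∘tabulate f x) fx)

∈-tabulate⁻ : ∀ {n} {f : Fin n → Bool} {x} → x ∈ tabulate f → f x ≡ true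
∈-tabulate⁻ {f = f} {x} x∈ = trans (sym (lookup∘tabulate f x)) ([]=⇒lookup x∈)

∣tabulate∣ : ∀ {n} (f : Fin n → Bool) → ∣ tabulate f ∣ ≡ ∑[ x < n ] bit (f x)
∣tabulate∣ f = trans (∣p∣≡∑ (tabulate f)) (sum-cong-≗ (cong bit ∘ lookup∘tabulate f))

bit-∨ : ∀ a b → bit (a ∨ b) ≤ bit a + bit b
bit-∨ true  b = s≤s z≤n
bit-∨ false b = ≤-refl

∣p∪q∣≤∣p∣+∣q∣ : ∀ {n} (p q : Subset n) → ∣ p ∪ q ∣ ≤ ∣ p ∣ + ∣ q ∣
∣p∪q∣≤∣p∣+∣q∣ {n} p q = begin
  ∣ p ∪ q ∣                                                  ≡⟨ ∣p∣≡∑ (p ∪ q) ⟩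
  ∑[ x < n ] bit (lookup (p ∪ q) x)                          ≡⟨ sum-cong-≗ (λ x → cong bit (lookup-zipWith _∨_ x p q)) ⟩
  ∑[ x < n ] bit (lookup p x ∨ lookup q x)                   ≤⟨ ∑-mono (λ x → bit-∨ (lookup p x) (lookup q x)) ⟩
  ∑[ x < n ] (bit (lookup p x) + bit (lookup q x))           ≡⟨ ∑-distrib-+ (bit ∘ lookup p) (bit ∘ lookup q) ⟩
  ∑[ x < n ] bit (lookup p x) + ∑[ x < n ] bit (lookup q x)  ≡⟨ cong₂ _+_ (∣p∣≡∑ p) (∣p∣≡∑ q) ⟨
  ∣ p ∣ + ∣ q ∣                                              ∎
  where open ≤-Reasoning

∣⋃∣≤∑ : ∀ {m n} (F : Fin m → Subset n) → ∣ ⋃ (List.tabulate F) ∣ ≤ ∑[ t < m ] ∣ F t ∣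
∣⋃∣≤∑ {zero} {n} F = ≤-reflexive (∣⊥∣≡0 n)
∣⋃∣≤∑ {suc m} F = ≤-trans (∣p∪q∣≤∣p∣+∣q∣ (F zero) _) (+-monoʳ-≤ ∣ F zero ∣ (∣⋃∣≤∑ (F ∘ suc)))

-- The union of F v over the v passing the test c. The closed neighbourhood N[S] and
-- every propagation step P^{i+1} of Defs are guarded unions of closed neighbourhoods.
guardedUnion : ∀ {m n} → (Fin m → Bool) → (Fin m → Subset n) → Subset n
guardedUnion {m} c F = ⋃ (map (λ v → if c v then F v else ⊥) (allFin m))

∈⋃⁻ : ∀ {m n} (F : Fin m → Subset n) (vs : List (Fin m)) {x} → x ∈ ⋃ (map F vs) → ∃[ v ] x ∈ F v
∈⋃⁻ F []ₗ       x∈ = ⊥-elim (∉⊥ x∈)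
∈⋃⁻ F (v ∷ₗ vs) x∈ with x∈p∪q⁻ (F v) _ x∈
... | inj₁ x∈Fv   = v , x∈Fv
... | inj₂ x∈rest = ∈⋃⁻ F vs x∈rest

∈⋃⁺ : ∀ {m n} (F : Fin m → Subset n) {vs v x} → v ∈ₗ vs → x ∈ F v → x ∈ ⋃ (map F vs)
∈⋃⁺ F (here refl) x∈ = x∈p∪q⁺ (inj₁ x∈)
∈⋃⁺ F (there v∈)  x∈ = x∈p∪q⁺ (inj₂ (∈⋃⁺ F v∈ x∈))

∈-guarded⁻ : ∀ {m n} (c : Fin m → Bool) (F : Fin m → Subset n) {x} →
  x ∈ guardedUnion c F → ∃[ v ] (c v ≡ true × x ∈ F v)
∈-guarded⁻ {m} c F x∈ with ∈⋃⁻ _ (allFin m) x∈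
... | v , x∈v with c v in cv
...   | true  = v , cv , x∈v
...   | false = ⊥-elim (∉⊥ x∈v)

∈-guarded⁺ : ∀ {m n} (c : Fin m → Bool) (F : Fin m → Subset n) {v x} →
  c v ≡ true → x ∈ F v → x ∈ guardedUnion c F
∈-guarded⁺ c F {v} cv x∈ = ∈⋃⁺ _ (∈-allFin v) (subst (λ b → _ ∈ (if b then F v else ⊥)) (sym cv) x∈)

image : ∀ {m n} → (Fin m → Fin n) → Subset m → Subset n
image f B = guardedUnion (lookup B) (λ t → ⁅ f t ⁆)

∈image⁺ : ∀ {m n} (f : Fin m → Fin n) {B t} → t ∈ B → f t ∈ image f B
∈image⁺ f {B} {t} t∈B = ∈-guarded⁺ (lookup B) (λ s → ⁅ f s ⁆) ([]=⇒lookup t∈B) (x∈⁅x⁆ (f t))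

∣image∣≤∣B∣ : ∀ {m n} (f : Fin m → Fin n) (B : Subset m) → ∣ image f B ∣ ≤ ∣ B ∣
∣image∣≤∣B∣ {m} {n} f B = begin
  ∣ image f B ∣                   ≡⟨ cong (∣_∣ ∘ ⋃) (map-tabulate id piece) ⟩
  ∣ ⋃ (List.tabulate piece) ∣     ≤⟨ ∣⋃∣≤∑ piece ⟩
  ∑[ t < m ] ∣ piece t ∣          ≡⟨ sum-cong-≗ (λ t → ∣piece∣ (lookup B t)) ⟩
  ∑[ t < m ] bit (lookup B t)     ≡⟨ ∣p∣≡∑ B ⟨
  ∣ B ∣                           ∎
  where
  open ≤-Reasoning
  piece : Fin m → Subset _
  piece t = if lookup B t then ⁅ f t ⁆ else ⊥
  ∣piece∣ : ∀ {t} b → ∣ (if b then ⁅ f t ⁆ else ⊥) ∣ ≡ bit b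
  ∣piece∣ {t} true  = ∣⁅x⁆∣≡1 (f t)
  ∣piece∣     false = ∣⊥∣≡0 n

module _ {n : ℕ} (H : Graph n) where

  ∈Nc⁻ : ∀ {v x} → x ∈ Nc H v → adj H v x ≡ true ⊎ x ≡ v
  ∈Nc⁻ {v} {x} x∈ with adj H v x | x ≟ v | ∈-tabulate⁻ x∈
  ... | true  | _       | _ = inj₁ refl
  ... | false | yes x≡v | _ = inj₂ x≡v
  ... | false | no _    | ()

  ∈Nc⁺ : ∀ {v x} → adj H v x ≡ true → x ∈ Nc H v
  ∈Nc⁺ {v} {x} vx = ∈-tabulate⁺ (cong (_∨ _) vx)

  ∈NcSet⁻ : ∀ {S x} → x ∈ NcSet H S → ∃[ v ] (v ∈ S × x ∈ Nc H v)
  ∈NcSet⁻ {S} x∈ with ∈-guarded⁻ (lookup S) (Nc H) x∈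
  ... | v , v∈S , x∈Nv = v , lookup⇒[]= v S v∈S , x∈Nv

  ∈NcSet⁺ : ∀ {S v x} → v ∈ S → x ∈ Nc H v → x ∈ NcSet H S
  ∈NcSet⁺ {S} v∈S = ∈-guarded⁺ (lookup S) (Nc H) ([]=⇒lookup v∈S)

  ∈P-suc⁻ : ∀ {k S i x} → x ∈ P H k S (suc i) →
    ∃[ v ] (v ∈ P H k S i × ∣ Nc H v ─ P H k S i ∣ ≤ k × x ∈ Nc H v)
  ∈P-suc⁻ {k} {S} {i} x∈ with ∈-guarded⁻ _ (Nc H) x∈
  ... | v , guard , x∈Nv with lookup (P H k S i) v in v∈P | guard
  ...   | true | small = v , lookup⇒[]= v _ v∈P , ≤ᵇ⇒≤ _ k (Equivalence.from T-≡ small) , x∈Nv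

nonempty : ∀ {n} {p : Subset n} → 1 ≤ ∣ p ∣ → Nonempty p
nonempty {n} {p} 1≤∣p∣ with nonempty? p
... | yes p≠∅ = p≠∅
... | no  p=∅ = contradiction (trans (cong ∣_∣ (Empty-unique p=∅)) (∣⊥∣≡0 n)) (λ ∣p∣≡0 → <⇒≱ 1≤∣p∣ (≤-reflexive ∣p∣≡0))

module BlowUp (M : ℕ) {n : ℕ} (G : Graph n) where

  π : Fin (M * n) → Fin n
  π x = proj₂ (remQuot {M} n x)

  layer : Fin (M * n) → Fin M
  layer x = proj₁ (remQuot {M} n x)

  copy : Fin M → Fin n → Fin (M * n)
  copy = combine

  π-copy : ∀ i u → π (copy i u) ≡ u
  π-copy i u = cong proj₂ (remQuot-combine i u)

  layer-copy : ∀ i u → layer (copy i u) ≡ i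
  layer-copy i u = cong proj₁ (remQuot-combine i u)

  copy-π : ∀ x → copy (layer x) (π x) ≡ x
  copy-π = combine-remQuot {M} n

  blowUp : Graph (M * n)
  blowUp = record
    { adj    = λ x y → adj G (π x) (π y)
    ; sym    = λ x y → adj-sym G (π x) (π y)
    ; irrefl = λ x → irrefl G (π x)
    }

  -- Each vertex of G[M] has M copies of every G-neighbour of its projection.
  deg-blowUp : ∀ x → deg blowUp x ≡ M * deg G (π x)
  deg-blowUp x = begin
    deg blowUp x                                             ≡⟨ ∣tabulate∣ (λ y → adj G (π x) (π y)) ⟩
    ∑[ y < M * n ] bit (adj G (π x) (π y))                   ≡⟨ ∑-combine M n _ ⟩
    ∑[ i < M ] ∑[ u < n ] bit (adj G (π x) (π (copy i u)))   ≡⟨ sum-cong-≗ (λ i → sum-cong-≗ (λ u →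
                                                                  cong (bit ∘ adj G (π x)) (π-copy i u))) ⟩
    ∑[ i < M ] ∑[ u < n ] bit (adj G (π x) u)                ≡⟨ ∑-const M _ ⟩
    M * ∑[ u < n ] bit (adj G (π x) u)                       ≡⟨ cong (M *_) (∣tabulate∣ (adj G (π x))) ⟨
    M * deg G (π x)                                          ∎
    where open ≡-Reasoning

  blowUp-regular : ∀ {r} → Regular G r → Regular blowUp (M * r)
  blowUp-regular reg x = trans (deg-blowUp x) (cong (M *_) (reg (π x)))

  lift-edge : ∀ {x c} (i : Fin M) → adj G (π x) c ≡ true → adj blowUp x (copy i c) ≡ true
  lift-edge {x} {c} i xc = trans (cong (adj G (π x)) (π-copy i c)) xc

  -- A walk of G from π x to π y lifts to a walk of G[M] through layer o; the trivial
  -- walk (π x = π y) is replaced by a detour through a neighbour, which exists by 'nbr'.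
  module _ (o : Fin M) (nbr : ∀ u → ∃[ w ] adj G u w ≡ true) where

    lift-walk : ∀ {a b} → Reachable G a b → ∀ {x y} → π x ≡ a → π y ≡ b → Reachable blowUp x y
    lift-walk (here {a}) {x} {y} refl πy≡a =
      step (lift-edge o aw) (step (trans (cong₂ (adj G) (π-copy o w) πy≡a) (trans (adj-sym G w a) aw)) here)
      where
      w : Fin n
      w = proj₁ (nbr a)
      aw : adj G a w ≡ true
      aw = proj₂ (nbr a)
    lift-walk (step {w = c} ac walk) refl πy≡b = step (lift-edge o ac) (lift-walk walk (π-copy o c) πy≡b)

    blowUp-connected : Connected G → Connected blowUp
    blowUp-connected conn x y = lift-walk (conn (π x) (π y)) refl refl

  onLayer : Fin M → Subset n → Subset (M * n)
  onLayer o T = tabulate (λ x → does (layer x ≟ o) ∧ lookup T (π x))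

  ∣onLayer∣ : ∀ o T → ∣ onLayer o T ∣ ≡ ∣ T ∣
  ∣onLayer∣ o T = begin
    ∣ onLayer o T ∣                                           ≡⟨ ∣tabulate∣ (λ x → does (layer x ≟ o) ∧ lookup T (π x)) ⟩
    ∑[ x < M * n ] bit (does (layer x ≟ o) ∧ lookup T (π x))  ≡⟨ ∑-combine M n _ ⟩
    ∑[ i < M ] ∑[ u < n ] bit (does (layer (copy i u) ≟ o) ∧ lookup T (π (copy i u)))
        ≡⟨ sum-cong-≗ (λ i → sum-cong-≗ (λ u → cong₂ (λ j v → bit (does (j ≟ o) ∧ lookup T v)) (layer-copy i u) (π-copy i u))) ⟩
    ∑[ i < M ] ∑[ u < n ] bit (does (i ≟ o) ∧ lookup T u)     ≡⟨ ∑-comm (λ i u → bit (does (i ≟ o) ∧ lookup T u)) ⟩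
    ∑[ u < n ] ∑[ i < M ] bit (does (i ≟ o) ∧ lookup T u)     ≡⟨ sum-cong-≗ (λ u → ∑-indicator o (λ _ → lookup T u)) ⟩
    ∑[ u < n ] bit (lookup T u)                               ≡⟨ ∣p∣≡∑ T ⟨
    ∣ T ∣                                                     ∎
    where open ≡-Reasoning

  onLayer-dominating : ∀ o {T} → IsTotalDominating G T → ∀ x → x ∈ NcSet blowUp (onLayer o T)
  onLayer-dominating o {T} total x = ∈NcSet⁺ blowUp (∈-tabulate⁺ t′∈) (∈Nc⁺ blowUp t′x)
    where
    t : Fin n
    t = proj₁ (total (π x))
    t′ : Fin (M * n)
    t′ = copy o t
    t′∈ : does (layer t′ ≟ o) ∧ lookup T (π t′) ≡ true
    t′∈ = begin
      does (layer t′ ≟ o) ∧ lookup T (π t′)  ≡⟨ cong₂ (λ j v → does (j ≟ o) ∧ lookup T v) (layer-copy o t) (π-copy o t) ⟩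
      does (o ≟ o) ∧ lookup T t              ≡⟨ cong₂ _∧_ (dec-true (o ≟ o) refl) ([]=⇒lookup (proj₁ (proj₂ (total (π x))))) ⟩
      true                                    ∎
      where open ≡-Reasoning
    t′x : adj blowUp t′ x ≡ true
    t′x = trans (cong (λ v → adj G v (π x)) (π-copy o t)) (trans (adj-sym G t (π x)) (proj₂ (proj₂ (total (π x)))))

  module Fibres (S : Subset (M * n)) where

    occupancy : Fin n → ℕ
    occupancy u = ∑[ i < M ] bit (lookup S (copy i u))

    ∣S∣≡∑occupancy : ∣ S ∣ ≡ ∑[ u < n ] occupancy u
    ∣S∣≡∑occupancy = begin
      ∣ S ∣                                              ≡⟨ ∣p∣≡∑ S ⟩
      ∑[ x < M * n ] bit (lookup S x)                    ≡⟨ ∑-combine M n _ ⟩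
      ∑[ i < M ] ∑[ u < n ] bit (lookup S (copy i u))    ≡⟨ ∑-comm (λ i u → bit (lookup S (copy i u))) ⟩
      ∑[ u < n ] occupancy u                             ∎
      where open ≡-Reasoning

    occupied : ∀ {v} → v ∈ S → 1 ≤ occupancy (π v)
    occupied {v} v∈S = subst (_≤ occupancy (π v)) (cong bit (trans (cong (lookup S) (copy-π v)) ([]=⇒lookup v∈S)))
                         (term≤∑ (λ i → bit (lookup S (copy i (π v)))) (layer v))

    vacant : Fin n → Subset (M * n)
    vacant u = tabulate (λ x → does (π x ≟ u) ∧ not (lookup S x))

    ∈vacant⁻ : ∀ {u y} → y ∈ vacant u → π y ≡ u × y ∉ S
    ∈vacant⁻ {u} {y} y∈ with π y ≟ u | lookup S y in Sy | ∈-tabulate⁻ y∈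
    ... | yes πy≡u | false | _ = πy≡u , λ y∈S → contradiction (trans (sym Sy) ([]=⇒lookup y∈S)) λ ()

    ∣vacant∣+occupancy : ∀ u → ∣ vacant u ∣ + occupancy u ≡ M
    ∣vacant∣+occupancy u = begin
      ∣ vacant u ∣ + occupancy u                                   ≡⟨ cong (_+ occupancy u) ∣vacant∣ ⟩
      ∑[ i < M ] bit (not (b i)) + ∑[ i < M ] bit (b i)            ≡⟨ ∑-distrib-+ (bit ∘ not ∘ b) (bit ∘ b) ⟨
      ∑[ i < M ] (bit (not (b i)) + bit (b i))                     ≡⟨ sum-cong-≗ (λ i → bit-not+bit (b i)) ⟩
      ∑[ i < M ] 1                                                 ≡⟨ ∑-const M 1 ⟩
      M * 1                                                        ≡⟨ *-identityʳ M ⟩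
      M                                                            ∎
      where
      open ≡-Reasoning
      b : Fin M → Bool
      b i = lookup S (copy i u)
      bit-not+bit : ∀ c → bit (not c) + bit c ≡ 1
      bit-not+bit true  = refl
      bit-not+bit false = refl
      ∣vacant∣ : ∣ vacant u ∣ ≡ ∑[ i < M ] bit (not (b i))
      ∣vacant∣ = begin
        ∣ vacant u ∣                                                        ≡⟨ ∣tabulate∣ (λ x → does (π x ≟ u) ∧ not (lookup S x)) ⟩
        ∑[ x < M * n ] bit (does (π x ≟ u) ∧ not (lookup S x))              ≡⟨ ∑-combine M n _ ⟩
        ∑[ i < M ] ∑[ w < n ] bit (does (π (copy i w) ≟ u) ∧ not (lookup S (copy i w)))
            ≡⟨ sum-cong-≗ (λ i → sum-cong-≗ (λ w → cong (λ v → bit (does (v ≟ u) ∧ not (lookup S (copy i w)))) (π-copy i w))) ⟩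
        ∑[ i < M ] ∑[ w < n ] bit (does (w ≟ u) ∧ not (lookup S (copy i w))) ≡⟨ sum-cong-≗ (λ i → ∑-indicator u (λ w → not (lookup S (copy i w)))) ⟩
        ∑[ i < M ] bit (not (b i))                                            ∎

    Lonely : Fin n → Set
    Lonely u = ∀ {v} → v ∈ S → adj G (π v) u ≢ true

    -- At step 0 a vacant copy could only be observed from S
    -- through an edge to u. At step i+1 it is observed by some v ∈ P^i adjacent to u in the
    -- projection, but then all vacant copies of u are unobserved closed neighbours of v, more
    -- than k of them, so v cannot propagate.
    vacant-unobserved : ∀ {k u} → Lonely u → k < ∣ vacant u ∣ →
      ∀ i {y} → y ∈ vacant u → y ∉ P blowUp k S i
    vacant-unobserved {k} {u} lonely many zero {y} y∈vacant y∈P₀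
      with ∈vacant⁻ y∈vacant | ∈NcSet⁻ blowUp y∈P₀
    ... | πy≡u , y∉S | v , v∈S , y∈Nv with ∈Nc⁻ blowUp y∈Nv
    ...   | inj₁ vy   = lonely v∈S (subst (λ w → adj G (π v) w ≡ true) πy≡u vy)
    ...   | inj₂ refl = y∉S v∈S
    vacant-unobserved {k} {u} lonely many (suc i) {y} y∈vacant y∈Pᵢ₊₁
      with ∈vacant⁻ y∈vacant | ∈P-suc⁻ blowUp {k} {S} {i} y∈Pᵢ₊₁
    ... | πy≡u , _ | v , v∈Pᵢ , few , y∈Nv with ∈Nc⁻ blowUp y∈Nv
    ...   | inj₂ refl = vacant-unobserved lonely many i y∈vacant v∈Pᵢ
    ...   | inj₁ vy   = <⇒≱ many (≤-trans (p⊆q⇒∣p∣≤∣q∣ vacant⊆) few)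
      where
      vacant⊆ : vacant u ⊆ Nc blowUp v ─ P blowUp k S i
      vacant⊆ {z} z∈vacant = x∈p∧x∉q⇒x∈p─q
        (∈Nc⁺ blowUp (subst (λ w → adj G (π v) w ≡ true) (trans πy≡u (sym (proj₁ (∈vacant⁻ z∈vacant)))) vy))
        (vacant-unobserved lonely many i z∈vacant)

    vacancies : ∀ {k u} → 2 + k ≤ M → occupancy u ≤ 1 → k < ∣ vacant u ∣
    vacancies {k} {u} M≥2+k occ≤1 = s≤s⁻¹ (begin
      2 + k                          ≤⟨ M≥2+k ⟩
      M                              ≡⟨ ∣vacant∣+occupancy u ⟨
      ∣ vacant u ∣ + occupancy u     ≤⟨ +-monoʳ-≤ ∣ vacant u ∣ occ≤1 ⟩
      ∣ vacant u ∣ + 1               ≡⟨ +-comm ∣ vacant u ∣ 1 ⟩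
      1 + ∣ vacant u ∣               ∎)
      where open ≤-Reasoning

    crowded : ∀ {k u} → 2 + k ≤ M → IsKPowerDominating blowUp k S → Lonely u → 2 ≤ occupancy u
    crowded {k} {u} M≥2+k kpd lonely with 2 ≤? occupancy u
    ... | yes 2≤occ = 2≤occ
    ... | no  2≰occ with vacancies M≥2+k (s≤s⁻¹ (≰⇒> 2≰occ))
    ...   | many with nonempty (≤-trans (s≤s z≤n) many)
    ...     | y , y∈vacant = ⊥-elim (vacant-unobserved lonely many (proj₁ (kpd y)) y∈vacant (proj₂ (kpd y)))

    -- It is total dominating, and it is no larger than S since each
    -- u is charged [c(u) ≥ 1] + [c(u) ≥ 2] ≤ c(u).
    module _ (nbr : ∀ u → ∃[ w ] adj G u w ≡ true) where

      projection : Subset n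
      projection = tabulate (λ u → 1 ≤ᵇ occupancy u)

      crowdedSet : Subset n
      crowdedSet = tabulate (λ u → 2 ≤ᵇ occupancy u)

      shadow : Subset n
      shadow = projection ∪ image (proj₁ ∘ nbr) crowdedSet

      shadow-total : ∀ {k} → 2 + k ≤ M → IsKPowerDominating blowUp k S → IsTotalDominating G shadow
      shadow-total M≥2+k kpd u with any? (λ t → (adj G u t ≟ᵇ true) ×-dec (1 ≤? occupancy t))
      ... | yes (t , ut , 1≤occ) = t , x∈p∪q⁺ (inj₁ (∈-tabulate⁺ (Equivalence.to T-≡ (≤⇒≤ᵇ 1≤occ)))) , ut
      ... | no  none = proj₁ (nbr u) , x∈p∪q⁺ (inj₂ (∈image⁺ (proj₁ ∘ nbr) u∈crowded)) , proj₂ (nbr u)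
        where
        lonely : Lonely u
        lonely {v} v∈S vu = none (π v , trans (adj-sym G u (π v)) vu , occupied v∈S)
        u∈crowded : u ∈ crowdedSet
        u∈crowded = ∈-tabulate⁺ (Equivalence.to T-≡ (≤⇒≤ᵇ (crowded M≥2+k kpd lonely)))

      ∣shadow∣≤∣S∣ : ∣ shadow ∣ ≤ ∣ S ∣
      ∣shadow∣≤∣S∣ = begin
        ∣ shadow ∣                                          ≤⟨ ∣p∪q∣≤∣p∣+∣q∣ projection _ ⟩
        ∣ projection ∣ + ∣ image (proj₁ ∘ nbr) crowdedSet ∣  ≤⟨ +-monoʳ-≤ ∣ projection ∣ (∣image∣≤∣B∣ (proj₁ ∘ nbr) crowdedSet) ⟩
        ∣ projection ∣ + ∣ crowdedSet ∣                      ≡⟨ cong₂ _+_ (∣tabulate∣ (λ u → 1 ≤ᵇ occupancy u)) (∣tabulate∣ (λ u → 2 ≤ᵇ occupancy u)) ⟩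
        ∑[ u < n ] bit (1 ≤ᵇ occupancy u) + ∑[ u < n ] bit (2 ≤ᵇ occupancy u)
            ≡⟨ ∑-distrib-+ (λ u → bit (1 ≤ᵇ occupancy u)) (λ u → bit (2 ≤ᵇ occupancy u)) ⟨
        ∑[ u < n ] (bit (1 ≤ᵇ occupancy u) + bit (2 ≤ᵇ occupancy u)) ≤⟨ ∑-mono (λ u → twoThresholds (occupancy u)) ⟩
        ∑[ u < n ] occupancy u                               ≡⟨ ∣S∣≡∑occupancy ⟨
        ∣ S ∣                                                ∎
        where
        open ≤-Reasoning
        twoThresholds : ∀ c → bit (1 ≤ᵇ c) + bit (2 ≤ᵇ c) ≤ c
        twoThresholds zero          = z≤n
        twoThresholds (suc zero)    = s≤s z≤n
        twoThresholds (suc (suc c)) = s≤s (s≤s z≤n)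

-- A decidable property of subsets that holds for some subset has a minimum size:
-- descend to a smaller witness while one exists.
module _ {n : ℕ} (G : Graph n) (Q : Subset n → Set) (Q? : ∀ S → Dec (Q S)) where

  minimumBelow : ∀ b S → Q S → ∣ S ∣ < b → ∃[ m ] IsMinSize G Q m
  minimumBelow (suc b) S q ∣S∣<1+b with anySubset? (λ S′ → Q? S′ ×-dec (∣ S′ ∣ <? ∣ S ∣))
  ... | yes (S′ , q′ , smaller) = minimumBelow b S′ q′ (<-≤-trans smaller (s≤s⁻¹ ∣S∣<1+b))
  ... | no  none                = ∣ S ∣ , (S , q , refl) , λ S′ q′ → ≮⇒≥ (λ smaller → none (S′ , q′ , smaller))

  minimum : ∀ S → Q S → ∃[ m ] IsMinSize G Q m
  minimum S q = minimumBelow (suc ∣ S ∣) S q ≤-refl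

neighbour : ∀ {n r} (G : Graph n) → Regular G r → 1 ≤ r → ∀ u → ∃[ w ] adj G u w ≡ true
neighbour G regular 1≤r u with nonempty (subst (1 ≤_) (sym (regular u)) 1≤r)
... | w , w∈N = w , ∈-tabulate⁻ w∈N

-- γ_t(G) exists when G has no isolated vertex (then V(G) is total dominating).
totalDominationNumber : ∀ {n} (G : Graph n) → (∀ u → ∃[ w ] adj G u w ≡ true) → ∃[ m ] TotalDomNumber G m
totalDominationNumber G nbr = minimum G (IsTotalDominating G) totalDominating? ⊤ (λ u → proj₁ (nbr u) , ∈⊤ , proj₂ (nbr u))
  where
  totalDominating? : ∀ S → Dec (IsTotalDominating G S)
  totalDominating? S = all? (λ v → any? (λ u → (u ∈? S) ×-dec (adj G v u ≟ᵇ true)))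

powerDomination-blowUp : ∀ k {n m} (G : Graph n) → (∀ u → ∃[ w ] adj G u w ≡ true) →
  TotalDomNumber G m → PowerDomNumber (BlowUp.blowUp (2 + k) G) k m
powerDomination-blowUp k G nbr ((T , total , ∣T∣≡m) , minimal) =
  (onLayer zero T , (λ x → 0 , onLayer-dominating zero total x) , trans (∣onLayer∣ zero T) ∣T∣≡m) ,
  λ S kpd → ≤-trans (minimal (shadow S nbr) (shadow-total S nbr ≤-refl kpd)) (∣shadow∣≤∣S∣ S nbr)
  where
  open BlowUp (2 + k) G
  open Fibres

-- The theorem: G[k+2] is connected, ((k+2) r)-regular, and γ_{p,k}(G[k+2]) = γ_t(G);
-- the order (2 + k) n of the blow-up is rewritten to (k + 2) n.
mainTheorem4 : (k r n : ℕ) → k ≥ 1 → r ≥ 1 → (G : Graph n) →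
    Connected G → Regular G r →
    ∃[ G' ] (Connected {(k + 2) * n} G' × Regular G' ((k + 2) * r) ×
      ∃[ m ] (PowerDomNumber G' k m × TotalDomNumber G m))
mainTheorem4 k r n _ r≥1 G connected regular =
  subst (λ M → ∃[ G' ] (Connected {M * n} G' × Regular G' (M * r) ×
                        ∃[ m ] (PowerDomNumber G' k m × TotalDomNumber G m)))
        (+-comm 2 k)
        ( blowUp , blowUp-connected zero nbr connected , blowUp-regular regular
        , m , powerDomination-blowUp k G nbr γₜ , γₜ )
  where
  open BlowUp (2 + k) G
  nbr : ∀ u → ∃[ w ] adj G u w ≡ true
  nbr = neighbour G regular r≥1
  m : ℕ
  m = proj₁ (totalDominationNumber G nbr)
  γₜ : TotalDomNumber G m
  γₜ = proj₂ (totalDominationNumber G nbr)
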